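{- Let $\mathcal{H}$ be an $r$-uniform $r$-partite linear hypergraph ($r\ge 3$). If $\mathcal{H}$ is $\mathcal{G}_r(3r-3,3)$-free, then it is also $\mathcal{G}_r(5r-7,5)$-free.
   Context: A hypergraph is linear if any two distinct edges share at most one vertex. An $r$-uniform hypergraph is $r$-partite if its vertex set is partitioned into $r$ parts such that every edge contains exactly one vertex of each part. An $r$-uniform hypergraph is $\mathcal{G}_r(v,e)$-free if the union of any $e$ distinct edges has at least $v+1$ vertices. -}

module Defs where

open import Data.Nat using (ℕ; _≤_; _+_)
import Data.Nat.Properties as ℕP
open import Data.Fin using (Fin)
open import Data.Vec using (Vec; lookup)
open import Data.List using (List; length; map; allFin; deduplicate)
open import Data.Nat.ListAction using (sum)
open import Data.List.Membership.Propositional using (_∈_)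
open import Data.List.Relation.Unary.All using (All)
open import Data.List.Relation.Unary.Unique.Propositional using (Unique)
open import Data.Product using (_×_)
open import Relation.Binary.PropositionalEquality using (_≡_; _≢_)
open import Relation.Nullary using (¬_)

-- The vertices of part i are pairs (i , x) with x : ℕ; an edge contains exactly
-- one vertex from each part, so it is encoded as a vector E : Vec ℕ r whose
-- i-th entry is the label of its vertex in part i.
Edge : ℕ → Set
Edge r = Vec ℕ r

Hypergraph : ℕ → Set
Hypergraph r = List (Edge r)

-- Two edges share the vertex (i , x) iff lookup E i ≡ lookup F i ≡ x.
-- Linear: two distinct edges share at most one vertex, i.e. they never agree
-- in two different parts.
Linear : ∀ {r} → Hypergraph r → Set
Linear {r} H = ∀ E F → E ∈ H → F ∈ H → E ≢ F →
  ∀ (i j : Fin r) → i ≢ j → ¬ (lookup E i ≡ lookup F i × lookup E j ≡ lookup F j)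

-- Number of vertices in the union of a list of edges: for each part i, the
-- number of distinct labels used in part i, summed over all parts.
unionSize : ∀ {r} → List (Edge r) → ℕ
unionSize {r} S = sum (map (λ i → length (deduplicate ℕP._≟_ (map (λ E → lookup E i) S))) (allFin r))

GFree : ∀ {r} → ℕ → ℕ → Hypergraph r → Set
GFree {r} v e H = ∀ (S : List (Edge r)) → Unique S → All (_∈ H) S → length S ≡ e →
  v + 1 ≤ unionSize S

module Submission where

-- Proof idea: double counting over the ten 3-element subsets of five edges.
--
-- Let S be five distinct edges and fix a part i; the five vertices of S in
-- part i take d distinct values.  A finite check shows that, summed over the
-- ten triples T ⊆ S, the number of distinct values of T in part i is at most
-- 15 + 3d (the "five-point inequality"; it is tight when d = 5).  Summing over
-- the r parts, the ten triples together span at most 15r + 3|⋃S| vertices.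
-- On the other hand each triple is three distinct edges, so by
-- G(3r-3,3)-freeness it spans at least 3r-2 vertices.  Hence
-- 10(3r-2) ≤ 15r + 3|⋃S|, i.e. |⋃S| ≥ 5r-6, which is G(5r-7,5)-freeness.

open import Defs
open import Data.Nat using (ℕ; zero; suc; _+_; _*_; _∸_; _≤_; _<_; z≤n; s≤s; _≤?_; _≟_)
open import Data.Nat.Properties
  using (suc-injective; +-mono-≤; +-comm; +-cancelˡ-≤; *-cancelˡ-<; m+n∸m≡n; module ≤-Reasoning)
open import Data.Nat.ListAction using (sum)
open import Data.Nat.Tactic.RingSolver using (solve-∀)
open import Data.Fin using (Fin)
open import Data.Vec using (lookup)
open import Data.List using (List; []; _∷_; _++_; length; map; filter; deduplicate; upTo; allFin)
open import Data.List.Properties using (filter-all; filter-reject; filter-accept; map-cong-local; length-tabulate)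
open import Data.List.Membership.Propositional using (_∈_)
open import Data.List.Membership.Propositional.Properties
  using (∈-deduplicate⁺; ∈-deduplicate⁻; ∈-map⁺; ∈-map⁻; ∈-upTo⁺)
open import Data.List.Membership.DecPropositional _≟_ using (_∈?_)
open import Data.List.Relation.Unary.All as All using (All; []; _∷_)
open import Data.List.Relation.Unary.All.Properties using (++⁺; map⁺)
open import Data.List.Relation.Unary.Any using (here; there)
open import Data.List.Relation.Unary.AllPairs using ([]; _∷_)
open import Data.List.Relation.Unary.Unique.Propositional using (Unique)
open import Data.List.Relation.Unary.Unique.DecPropositional.Properties _≟_ using (deduplicate-!)
open import Data.Product using (_,_)
open import Relation.Binary.PropositionalEquality
  using (_≡_; refl; sym; trans; cong; subst; subst₂; module ≡-Reasoning)
open import Relation.Nullary using (¬_; Dec; yes; no; ¬?; contradiction)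
open import Relation.Nullary.Decidable using (toWitness)
open import Function using (_∘_; id; _|>_)

#distinct : List ℕ → ℕ
#distinct xs = length (deduplicate _≟_ xs)

-- A structurally recursive count of distinct entries (an entry is counted at
-- its last occurrence); it is the convenient form for relabelling arguments.
distinct : List ℕ → ℕ
distinct []       = 0
distinct (x ∷ xs) with x ∈? xs
... | yes _ = distinct xs
... | no  _ = suc (distinct xs)

length-remove : ∀ x ys → Unique ys → x ∈ ys → suc (length (filter (¬? ∘ (x ≟_)) ys)) ≡ length ys
length-remove x (y ∷ ys) (y∉ys ∷ _) (here refl) =
  cong suc (trans (cong length (filter-reject (¬? ∘ (x ≟_)) {x} {ys} (λ x≢x → x≢x refl)))
                  (cong length (filter-all (¬? ∘ (x ≟_)) y∉ys)))
length-remove x (y ∷ ys) (y∉ys ∷ u) (there x∈ys) =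
  trans (cong (suc ∘ length) (filter-accept (¬? ∘ (x ≟_)) {y} {ys} (λ x≡y → All.lookup y∉ys x∈ys (sym x≡y))))
        (cong suc (length-remove x ys u x∈ys))

#distinct≡distinct : ∀ xs → #distinct xs ≡ distinct xs
#distinct≡distinct [] = refl
#distinct≡distinct (x ∷ xs) with x ∈? xs
... | yes x∈xs = trans (length-remove x (deduplicate _≟_ xs) (deduplicate-! xs) (∈-deduplicate⁺ _≟_ x∈xs))
                       (#distinct≡distinct xs)
... | no  x∉xs = cong suc (trans (cong length (filter-all (¬? ∘ (x ≟_)) x∉dedup)) (#distinct≡distinct xs))
  where
  x∉dedup : All (λ y → ¬ (x ≡ y)) (deduplicate _≟_ xs)
  x∉dedup = All.tabulate λ y∈ x≡y → x∉xs (subst (_∈ xs) (sym x≡y) (∈-deduplicate⁻ _≟_ xs y∈))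

InjectiveOn : (ℕ → ℕ) → List ℕ → Set
InjectiveOn g xs = ∀ {x y} → x ∈ xs → y ∈ xs → g x ≡ g y → x ≡ y

distinct-map : ∀ g xs → InjectiveOn g xs → distinct (map g xs) ≡ distinct xs
distinct-map g [] inj = refl
distinct-map g (x ∷ xs) inj with x ∈? xs | g x ∈? map g xs
... | yes _    | yes _    = distinct-map g xs (λ p q → inj (there p) (there q))
... | no  _    | no  _    = cong suc (distinct-map g xs (λ p q → inj (there p) (there q)))
... | yes x∈xs | no  gx∉  = contradiction (∈-map⁺ g x∈xs) gx∉
... | no  x∉xs | yes gx∈  with ∈-map⁻ g gx∈
...   | y , y∈xs , gx≡gy = contradiction (subst (_∈ xs) (sym (inj (here refl) (there y∈xs) gx≡gy)) y∈xs) x∉xs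

#distinct-map : ∀ g xs → InjectiveOn g xs → #distinct (map g xs) ≡ #distinct xs
#distinct-map g xs inj = begin
  #distinct (map g xs) ≡⟨ #distinct≡distinct (map g xs) ⟩
  distinct (map g xs)  ≡⟨ distinct-map g xs inj ⟩
  distinct xs          ≡⟨ sym (#distinct≡distinct xs) ⟩
  #distinct xs         ∎
  where open ≡-Reasoning

-- Position of the first occurrence of x in a list (the length, if absent).
-- Restricted to the entries of the list it is an injective relabelling into
-- {0, …, length − 1}.
position : List ℕ → ℕ → ℕ
position []       x = 0
position (y ∷ ys) x with x ≟ y
... | yes _ = 0
... | no  _ = suc (position ys x)

position-injective : ∀ ys → InjectiveOn (position ys) ys
position-injective (z ∷ zs) {x} {y} x∈ y∈ eq with x ≟ z | y ≟ z
... | yes x≡z | yes y≡z = trans x≡z (sym y≡z)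
... | yes _   | no  _   = contradiction eq (λ ())
... | no  _   | yes _   = contradiction eq (λ ())
position-injective (z ∷ zs) (here x≡z) _ _ | no x≢z | no _ = contradiction x≡z x≢z
position-injective (z ∷ zs) _ (here y≡z) _ | no _ | no y≢z = contradiction y≡z y≢z
position-injective (z ∷ zs) (there x∈) (there y∈) eq | no _ | no _ =
  position-injective zs x∈ y∈ (suc-injective eq)

position-< : ∀ ys {x} → x ∈ ys → position ys x < length ys
position-< (z ∷ zs) {x} x∈ with x ≟ z
position-< (z ∷ zs) _          | yes _   = s≤s z≤n
position-< (z ∷ zs) (here x≡z) | no  x≢z = contradiction x≡z x≢z
position-< (z ∷ zs) (there x∈) | no  _   = s≤s (position-< zs x∈)

choose : {A : Set} → ℕ → List A → List (List A)
choose zero    xs       = [] ∷ []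
choose (suc k) []       = []
choose (suc k) (x ∷ xs) = map (x ∷_) (choose k xs) ++ choose (suc k) xs

module _ {A : Set} where

  choose-All : ∀ {P : A → Set} k {xs} → All P xs → All (All P) (choose k xs)
  choose-All zero    {xs}     _          = [] ∷ []
  choose-All (suc k) {[]}     _          = []
  choose-All (suc k) {x ∷ xs} (px ∷ pxs) =
    ++⁺ (map⁺ (All.map (px ∷_) (choose-All k pxs))) (choose-All (suc k) pxs)

  choose-Unique : ∀ k {xs : List A} → Unique xs → All Unique (choose k xs)
  choose-Unique zero    {xs}     _            = [] ∷ []
  choose-Unique (suc k) {[]}     _            = []
  choose-Unique (suc k) {x ∷ xs} (x∉xs ∷ uxs) =
    ++⁺ (map⁺ (All.zipWith (λ (x∉T , uT) → x∉T ∷ uT) (choose-All k x∉xs , choose-Unique k uxs)))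
        (choose-Unique (suc k) uxs)

  choose-length : ∀ k (xs : List A) → All (λ T → length T ≡ k) (choose k xs)
  choose-length zero    xs       = refl ∷ []
  choose-length (suc k) []       = []
  choose-length (suc k) (x ∷ xs) =
    ++⁺ (map⁺ (All.map (cong suc) (choose-length k xs))) (choose-length (suc k) xs)

FivePoint : List ℕ → Set
FivePoint xs = sum (map #distinct (choose 3 xs)) ≤ 15 + 3 * #distinct xs

-- For labels in {0, …, 4} it is checked by evaluating all 5⁵ cases.
fivePoint-small : ∀ {a b c d e} → All (_< 5) (a ∷ b ∷ c ∷ d ∷ e ∷ []) →
  FivePoint (a ∷ b ∷ c ∷ d ∷ e ∷ [])
fivePoint-small (a<5 ∷ b<5 ∷ c<5 ∷ d<5 ∷ e<5 ∷ []) =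
  at e<5 (at d<5 (at c<5 (at b<5 (at a<5 table))))
  where
  Below5 : (ℕ → Set) → Set
  Below5 P = All P (upTo 5)

  at : ∀ {P : ℕ → Set} {x} → x < 5 → Below5 P → P x
  at x<5 table = All.lookup table (∈-upTo⁺ x<5)

  below5? : ∀ {P : ℕ → Set} → (∀ x → Dec (P x)) → Dec (Below5 P)
  below5? P? = All.all? P? (upTo 5)

  table : Below5 λ a → Below5 λ b → Below5 λ c → Below5 λ d → Below5 λ e →
            FivePoint (a ∷ b ∷ c ∷ d ∷ e ∷ [])
  table = toWitness {a? = below5? λ a → below5? λ b → below5? λ c → below5? λ d → below5? λ e → _ ≤? _} _

-- In general, relabel the entries by their positions, which lie in {0, …, 4}.
fivePoint : ∀ a b c d e → FivePoint (a ∷ b ∷ c ∷ d ∷ e ∷ [])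
fivePoint a b c d e =
  subst₂ (λ m n → m ≤ 15 + 3 * n) (cong sum (map-cong-local triples-relabel)) (relabel (All.tabulate id))
    (fivePoint-small (map⁺ (All.tabulate (position-< L))))
  where
  L : List ℕ
  L = a ∷ b ∷ c ∷ d ∷ e ∷ []

  relabel : ∀ {T} → All (_∈ L) T → #distinct (map (position L) T) ≡ #distinct T
  relabel T⊆L = #distinct-map (position L) _
    (λ x∈T y∈T → position-injective L (All.lookup T⊆L x∈T) (All.lookup T⊆L y∈T))

  triples-relabel : All (λ T → #distinct (map (position L) T) ≡ #distinct T) (choose 3 L)
  triples-relabel = All.map relabel (choose-All 3 (All.tabulate id))

module _ {A : Set} where

  sum-map-+ : ∀ (f g : A → ℕ) xs → sum (map (λ x → f x + g x) xs) ≡ sum (map f xs) + sum (map g xs)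
  sum-map-+ f g []       = refl
  sum-map-+ f g (x ∷ xs) = begin
    f x + g x + sum (map (λ x → f x + g x) xs)   ≡⟨ cong (f x + g x +_) (sum-map-+ f g xs) ⟩
    f x + g x + (sum (map f xs) + sum (map g xs)) ≡⟨ interchange (f x) (g x) _ _ ⟩
    f x + sum (map f xs) + (g x + sum (map g xs)) ∎
    where
    open ≡-Reasoning
    interchange : ∀ a b c d → a + b + (c + d) ≡ a + c + (b + d)
    interchange = solve-∀

  sum-map-≥ : ∀ (f : A → ℕ) {m} xs → All (λ x → m ≤ f x) xs → length xs * m ≤ sum (map f xs)
  sum-map-≥ f []       []         = z≤n
  sum-map-≥ f (x ∷ xs) (m≤ ∷ m≤s) = +-mono-≤ m≤ (sum-map-≥ f xs m≤s)

module _ {r : ℕ} where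

  column : Fin r → List (Edge r) → List ℕ
  column i T = map (λ E → lookup E i) T

  spanOn : List (Fin r) → List (Edge r) → ℕ
  spanOn parts T = sum (map (λ i → #distinct (column i T)) parts)

  triples-span : ∀ (a b c d e : Edge r) parts →
    sum (map (spanOn parts) (choose 3 (a ∷ b ∷ c ∷ d ∷ e ∷ []))) ≤
      15 * length parts + 3 * spanOn parts (a ∷ b ∷ c ∷ d ∷ e ∷ [])
  triples-span a b c d e []       = z≤n
  triples-span a b c d e (i ∷ is) = begin
    sum (map (spanOn (i ∷ is)) Ts)
      ≡⟨ sum-map-+ (#distinct ∘ column i) (spanOn is) Ts ⟩
    sum (map (#distinct ∘ column i) Ts) + sum (map (spanOn is) Ts)
      ≤⟨ +-mono-≤ (fivePoint (lookup a i) (lookup b i) (lookup c i) (lookup d i) (lookup e i))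
                  (triples-span a b c d e is) ⟩
    (15 + 3 * #distinct (column i S)) + (15 * length is + 3 * spanOn is S)
      ≡⟨ regroup (#distinct (column i S)) (length is) (spanOn is S) ⟩
    15 * length (i ∷ is) + 3 * spanOn (i ∷ is) S ∎
    where
    open ≤-Reasoning
    S : List (Edge r)
    S = a ∷ b ∷ c ∷ d ∷ e ∷ []
    Ts : List (List (Edge r))
    Ts = choose 3 S
    regroup : ∀ p n u → (15 + 3 * p) + (15 * n + 3 * u) ≡ 15 * suc n + 3 * (p + u)
    regroup = solve-∀

  triples-large : ∀ {v} {H : Hypergraph r} {S} → GFree v 3 H → Unique S → All (_∈ H) S →
    All (λ T → v + 1 ≤ unionSize T) (choose 3 S)
  triples-large {S = S} free uniqueS S⊆H = All.tabulate λ T∈ →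
    free _ (All.lookup (choose-Unique 3 uniqueS) T∈) (All.lookup (choose-All 3 S⊆H) T∈)
           (All.lookup (choose-length 3 S) T∈)

-- The two thresholds of the theorem without truncated subtraction, for r = 3 + k.
threshold₃ : ∀ k → 3 * (3 + k) ∸ 3 ≡ 3 * k + 6
threshold₃ k = trans (cong (_∸ 3) (expand k)) (m+n∸m≡n 3 (3 * k + 6))
  where
  expand : ∀ k → 3 * (3 + k) ≡ 3 + (3 * k + 6)
  expand = solve-∀

threshold₅ : ∀ k → 5 * (3 + k) ∸ 7 ≡ 5 * k + 8
threshold₅ k = trans (cong (_∸ 7) (expand k)) (m+n∸m≡n 7 (5 * k + 8))
  where
  expand : ∀ k → 5 * (3 + k) ≡ 7 + (5 * k + 8)
  expand = solve-∀

-- The arithmetic of the double count: if ten triples of at least 3r − 2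
-- vertices each fit into 15r + 3u, then u ≥ 5r − 6.  (Cancel 15r, then 3.)
doubleCount : ∀ r u → 3 ≤ r → 10 * (3 * r ∸ 3 + 1) ≤ 15 * r + 3 * u → 5 * r ∸ 7 + 1 ≤ u
doubleCount (suc (suc (suc k))) u (s≤s (s≤s (s≤s z≤n))) h =
  subst (_≤ u) (trans (+-comm 1 (5 * k + 8)) (cong (_+ 1) (sym (threshold₅ k))))
    (*-cancelˡ-< 3 (5 * k + 8) u 3[5k+8]<3u)
  where
  split : ∀ k → 10 * (3 * k + 6 + 1) ≡ 15 * (3 + k) + suc (3 * (5 * k + 8))
  split = solve-∀

  3[5k+8]<3u : 3 * (5 * k + 8) < 3 * u
  3[5k+8]<3u = +-cancelˡ-≤ (15 * (3 + k)) _ _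
    (subst (λ n → 10 * (n + 1) ≤ 15 * (3 + k) + 3 * u) (threshold₃ k) h
      |> subst (_≤ 15 * (3 + k) + 3 * u) (split k))

fiveEdges : ∀ r → 3 ≤ r → (H : Hypergraph r) → GFree (3 * r ∸ 3) 3 H →
  ∀ (a b c d e : Edge r) → let S = a ∷ b ∷ c ∷ d ∷ e ∷ [] in Unique S → All (_∈ H) S →
  5 * r ∸ 7 + 1 ≤ unionSize S
fiveEdges r 3≤r H free₃ a b c d e uniqueS S⊆H = doubleCount r _ 3≤r (begin
  10 * (3 * r ∸ 3 + 1)
    ≤⟨ sum-map-≥ unionSize (choose 3 S) (triples-large free₃ uniqueS S⊆H) ⟩
  sum (map unionSize (choose 3 S))
    ≤⟨ triples-span a b c d e (allFin r) ⟩
  15 * length (allFin r) + 3 * unionSize S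
    ≡⟨ cong (λ n → 15 * n + 3 * unionSize S) (length-tabulate {n = r} id) ⟩
  15 * r + 3 * unionSize S ∎)
  where
  open ≤-Reasoning
  S : List (Edge r)
  S = a ∷ b ∷ c ∷ d ∷ e ∷ []

theorem13 : (r : ℕ) → 3 ≤ r → (H : Hypergraph r) → Linear H →
    GFree (3 * r ∸ 3) 3 H → GFree (5 * r ∸ 7) 5 H
theorem13 r 3≤r H _ free₃ (a ∷ b ∷ c ∷ d ∷ e ∷ []) uniqueS S⊆H refl =
  fiveEdges r 3≤r H free₃ a b c d e uniqueS S⊆H
theorem13 r _ _ _ _ []                          _ _ ()
theorem13 r _ _ _ _ (_ ∷ [])                    _ _ ()
theorem13 r _ _ _ _ (_ ∷ _ ∷ [])                _ _ ()
theorem13 r _ _ _ _ (_ ∷ _ ∷ _ ∷ [])            _ _ ()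
theorem13 r _ _ _ _ (_ ∷ _ ∷ _ ∷ _ ∷ [])        _ _ ()
theorem13 r _ _ _ _ (_ ∷ _ ∷ _ ∷ _ ∷ _ ∷ _ ∷ _) _ _ ()
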